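{- Run Algorithm DECOMP on a binary tree $T^b$ with $n$ vertices. For any $i\in[I-1]$, each component $c\in C_{i+1}$ is obtained by merging a connected (in the component tree $T_i$) subset of the components in $C_i$.
   Context: Algorithm DECOMP (input: binary tree $T^b$ with $n$ vertices, parameter $m$). A component is a set of vertices of $T^b$; contracting all components gives the component tree, in which a component's parent/children are the components adjacent to it toward/away from the root. Initially $C$ is the set of singleton components $\{v\}$, $v\in V(T^b)$, and $F=\emptyset$ ($F$ holds "completed" components). While $|C|>14m$, do one iteration: set $S=\emptyset$; for each $c\in C\setminus F$: if $c$ is the root component, add $c$ to $S$; else if $c$ has exactly two children components, add $c$ to $S$; else if the parent component of $c$ is in $F$, add $c$ to $S$; else if $c$ has exactly one child component, add $c$ to $S$ independently with probability $1/2$. Then for each $c\in C\setminus(F\cup S)$, let $d$ be the closest ancestor of $c$ (in the component tree) that is in $S$, and merge $c$ into $d$. Finally, every component in $C\setminus F$ containing at least $n/m$ vertices of $T^b$ is added to $F$. Let $I$ be the number of iterations; for $i\in[I]$, $C_i$ and $F_i$ are the values of $C$ and $F$ at the start of iteration $i$, $S_i$ is the value of $S$ at the end of iteration $i$, and $T_i$ is the rooted component tree obtained by contracting all components of $C_i$ (so $T_1=T^b$). -}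

module Defs where

open import Data.Nat using (ℕ; _*_; _≤_; _<_)
open import Data.Bool using (Bool; true)
open import Data.Maybe using (Maybe; just; nothing)
open import Data.Fin using (Fin)
open import Data.Fin.Subset using (Subset; _∈_; ∣_∣; ⁅_⁆)
open import Data.List using (List; []; length; map; allFin)
open import Data.List.Membership.Propositional using () renaming (_∈_ to _∈ₗ_; _∉_ to _∉ₗ_)
open import Data.List.Relation.Unary.Unique.Propositional using (Unique)
open import Data.Product using (Σ; ∃; ∃-syntax; _×_; _,_)
open import Data.Sum using (_⊎_)
open import Function.Bundles using (_⇔_)
open import Relation.Nullary using (¬_)
open import Relation.Binary.PropositionalEquality using (_≡_; _≢_)
open import Relation.Binary.Construct.Closure.Transitive using (TransClosure)
open import Relation.Binary.Construct.Closure.ReflexiveTransitive using (Star)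

record BinaryTree (n : ℕ) : Set where
  field
    root     : Fin n
    parent   : Fin n → Maybe (Fin n)
    root-top : parent root ≡ nothing
    -- every vertex reaches the root by following parent pointers (so no cycles)
    toRoot   : ∀ v → Star (λ u w → parent u ≡ just w) v root
    -- every vertex has at most two children
    binary   : ∀ v a b c → parent a ≡ just v → parent b ≡ just v → parent c ≡ just v →
               a ≡ b ⊎ a ≡ c ⊎ b ≡ c
open BinaryTree public

Component : ℕ → Set
Component n = Subset n

State : ℕ → Set
State n = List (Component n) × List (Component n)   -- (C , F)

module _ {n : ℕ} (T : BinaryTree n) where

  -- a is a child component of b in the component tree of C
  ChildOf : List (Component n) → Component n → Component n → Set
  ChildOf C a b = a ∈ₗ C × b ∈ₗ C × a ≢ b ×
                  ∃[ u ] ∃[ w ] (u ∈ a × parent T u ≡ just w × w ∈ b)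

  DescOf : List (Component n) → Component n → Component n → Set
  DescOf C = TransClosure (ChildOf C)

  IsRootComp : Component n → Set
  IsRootComp c = root T ∈ c

  TwoChildren : List (Component n) → Component n → Set
  TwoChildren C c = ∃[ a ] ∃[ b ] (a ≢ b × ChildOf C a c × ChildOf C b c ×
                      (∀ e → ChildOf C e c → e ≡ a ⊎ e ≡ b))

  OneChild : List (Component n) → Component n → Set
  OneChild C c = ∃[ a ] (ChildOf C a c × (∀ e → ChildOf C e c → e ≡ a))

  ParentIn : List (Component n) → List (Component n) → Component n → Set
  ParentIn C F c = ∃[ p ] (ChildOf C c p × p ∈ₗ F)

  ClosestIn : List (Component n) → (Component n → Set) → Component n → Component n → Set
  ClosestIn C S c d = S d × DescOf C c d ×
                      (∀ e → DescOf C c e → DescOf C e d → ¬ S e)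

  NewComp : List (Component n) → List (Component n) → (Component n → Set) → Component n → Set
  NewComp C F S x =
    x ∈ₗ F ⊎
    ∃[ d ] (S d × (∀ v → (v ∈ x) ⇔ (v ∈ d ⊎
               ∃[ c ] (c ∈ₗ C × c ∉ₗ F × ¬ S c × ClosestIn C S c d × v ∈ c))))

  -- One iteration of the while loop of DECOMP, for some outcome of the coin flips.
  record Step (m : ℕ) (s s' : State n) : Set₁ where
    constructor mkStep
    C  = Data.Product.proj₁ s
    F  = Data.Product.proj₂ s
    C' = Data.Product.proj₁ s'
    F' = Data.Product.proj₂ s'
    field
      loop  : 14 * m < length C
      coin  : Component n → Bool
      S     : Component n → Set
      S-def : ∀ c → S c ⇔ (c ∈ₗ C × c ∉ₗ F ×
                (IsRootComp c ⊎ TwoChildren C c ⊎ ParentIn C F c ⊎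
                 (OneChild C c × coin c ≡ true)))
      C'-unique : Unique C'
      C'-def    : ∀ x → x ∈ₗ C' ⇔ NewComp C F S x
      -- "at least n/m vertices" written as n ≤ |x| * m  (m > 0)
      F'-def    : ∀ x → x ∈ₗ F' ⇔ (x ∈ₗ F ⊎ (x ∈ₗ C' × x ∉ₗ F × n ≤ ∣ x ∣ * m))

  initial : State n
  initial = map ⁅_⁆ (allFin n) , []

  data Reachable (m : ℕ) : State n → Set₁ where
    start : Reachable m initial
    next  : ∀ {s s'} → Reachable m s → Step m s s' → Reachable m s'

  ConnectedIn : List (Component n) → List (Component n) → Set
  ConnectedIn C K = ∀ a b → a ∈ₗ K → b ∈ₗ K →
    Star (λ p q → p ∈ₗ K × q ∈ₗ K × (ChildOf C p q ⊎ ChildOf C q p)) a b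

-- A component x of C' is either a completed component (already in C, since F ⊆ C holds at
-- every reachable state) or a component d ∈ S together with the components whose closest
-- S-ancestor is d. Every component on the tree path from such a c up to d also has d as its
-- closest S-ancestor, so taking d, finitely many such c covering x, and their whole paths to d
-- gives a set of components of C that is connected through d and whose union is x.
module Submission where

open import Defs
open import Level using (Level)
open import Data.Nat using (ℕ; _<_)
open import Data.Fin using (Fin)
open import Data.Fin.Subset using (_∈_)
open import Data.Fin.Subset.Properties using (_∈?_)
open import Data.List using (List; []; _∷_; concatMap; allFin)
open import Data.List.Membership.Propositional using (find; lose) renaming (_∈_ to _∈ₗ_; _∉_ to _∉ₗ_)
open import Data.List.Membership.Propositional.Properties using (∈-concatMap⁺; ∈-concatMap⁻; ∈-allFin)
open import Data.List.Relation.Unary.Any using (here; there)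
open import Data.Product using (Σ; ∃-syntax; _×_; _,_; proj₁; proj₂)
open import Data.Sum using (_⊎_; inj₁; inj₂)
open import Function using (id)
open import Function.Bundles using (_⇔_; mk⇔; Equivalence)
open import Relation.Nullary using (¬_; yes; no; contradiction)
open import Relation.Nullary.Decidable using (_×-dec_; ¬?)
open import Relation.Unary using (Pred; Decidable)
open import Relation.Binary using (Rel; Symmetric)
open import Relation.Binary.PropositionalEquality using (_≢_; refl)
open import Relation.Binary.Construct.Closure.Transitive using (TransClosure; [_]; _∷_)
open import Relation.Binary.Construct.Closure.ReflexiveTransitive using (Star; ε; _◅_; _◅◅_; reverse; gmap)

open Equivalence

private variable
  a p q r : Level
  A : Set a

finite-choice : ∀ {n} {P : Pred (Fin n) p} {Q : A → Fin n → Set q} → Decidable P →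
                (∀ {v} → P v → ∃[ x ] Q x v) →
                ∃[ L ] (∀ {v} → P v → ∃[ x ] (x ∈ₗ L × Q x v))
finite-choice {A = A} {n = n} {P = P} {Q = Q} P? choose = concatMap pick (allFin n) , complete
  where
  pick : Fin n → List A
  pick v with P? v
  ... | yes pv = proj₁ (choose pv) ∷ []
  ... | no _   = []

  pick-complete : ∀ v → P v → ∃[ x ] (x ∈ₗ pick v × Q x v)
  pick-complete v pv with P? v
  ... | yes pv′ = let (x , qx) = choose pv′ in x , here refl , qx
  ... | no ¬pv  = contradiction pv ¬pv

  complete : ∀ {v} → P v → ∃[ x ] (x ∈ₗ concatMap pick (allFin n) × Q x v)
  complete {v} pv =
    let (x , x∈pick , qx) = pick-complete v pv
    in x , ∈-concatMap⁺ pick (lose (∈-allFin v) x∈pick) , qx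

hub-connected : {E : Rel A r} {P : Pred A p} {h : A} → Symmetric E →
                (∀ {x} → P x → Star E x h) → ∀ {x y} → P x → P y → Star E x y
hub-connected sym to-hub px py = to-hub px ◅◅ reverse sym (to-hub py)

module _ {R : Rel A r} where

  -- the nodes of a path, excluding its target
  pathNodes : ∀ {x y} → TransClosure R x y → List A
  pathNodes {x} [ _ ]    = x ∷ []
  pathNodes {x} (_ ∷ ps) = x ∷ pathNodes ps

  source∈pathNodes : ∀ {x y} (ps : TransClosure R x y) → x ∈ₗ pathNodes ps
  source∈pathNodes [ _ ]   = here refl
  source∈pathNodes (_ ∷ _) = here refl

  InducedOn : Pred A p → Rel A _
  InducedOn P x y = P x × P y × R x y

  pathNodes-reach : {P : Pred A p} → ∀ {x y} (ps : TransClosure R x y) →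
                    (∀ {z} → z ∈ₗ pathNodes ps → P z) → P y →
                    ∀ {z} → z ∈ₗ pathNodes ps → Star (InducedOn P) z y
  pathNodes-reach [ xRy ] nodes∈P py (here refl) = (nodes∈P (here refl) , py , xRy) ◅ ε
  pathNodes-reach (xRz ∷ ps) nodes∈P py (here refl) =
    (nodes∈P (here refl) , nodes∈P (there (source∈pathNodes ps)) , xRz) ◅
      pathNodes-reach ps (λ z∈ → nodes∈P (there z∈)) py (source∈pathNodes ps)
  pathNodes-reach (_ ∷ ps) nodes∈P py (there z∈) = pathNodes-reach ps (λ z∈ → nodes∈P (there z∈)) py z∈

module _ {n : ℕ} (T : BinaryTree n) where

  ConnectedMergeOf : List (Component n) → Component n → List (Component n) → Set
  ConnectedMergeOf C x K = K ≢ [] × (∀ c → c ∈ₗ K → c ∈ₗ C) ×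
                           (∀ v → (v ∈ x) ⇔ (∃[ c ] (c ∈ₗ K × v ∈ c))) ×
                           ConnectedIn T C K

  completed⊆components : ∀ {m C F} → Reachable T m (C , F) → ∀ {x} → x ∈ₗ F → x ∈ₗ C
  completed⊆components (next _ st) {x} x∈F with to (Step.F'-def st x) x∈F
  ... | inj₁ x∈F₀       = from (Step.C'-def st x) (inj₁ x∈F₀)
  ... | inj₂ (x∈C′ , _) = x∈C′

  singleton-mergeOf : ∀ {C x} → x ∈ₗ C → ConnectedMergeOf C x (x ∷ [])
  singleton-mergeOf x∈C =
    (λ ()) , (λ { _ (here refl) → x∈C }) ,
    (λ v → mk⇔ (λ v∈x → _ , here refl , v∈x) (λ { (_ , here refl , v∈x) → v∈x })) ,
    (λ { _ _ (here refl) (here refl) → ε })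

  module Merge (C F : List (Component n)) (S : Component n → Set)
               (S-parentInF : ∀ {c} → c ∈ₗ C → c ∉ₗ F → ParentIn T C F c → S c)
               (d : Component n) where

    MergesInto : Component n → Set
    MergesInto c = c ∈ₗ C × c ∉ₗ F × ¬ S c × ClosestIn T C S c d

    -- the parent y of c is not in F, for otherwise c would have been put into S
    mergesInto-along : ∀ {c} (ps : DescOf T C c d) → MergesInto c →
                       ∀ {e} → e ∈ₗ pathNodes ps → MergesInto e
    mergesInto-along [ _ ] mc (here refl) = mc
    mergesInto-along (_ ∷ _) mc (here refl) = mc
    mergesInto-along (cRy ∷ ps) (c∈C , c∉F , ¬Sc , Sd , _ , closest) (there e∈) =
      mergesInto-along ps (y∈C , y∉F , ¬Sy , Sd , ps , closest-y) e∈
      where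
      y∈C = proj₁ (proj₂ cRy)
      y∉F = λ y∈F → ¬Sc (S-parentInF c∈C c∉F (_ , cRy , y∈F))
      ¬Sy = closest _ [ cRy ] ps
      closest-y = λ f y<f f<d → closest f (cRy ∷ y<f) f<d

    Merged : Set
    Merged = Σ (Component n) MergesInto

    pathToTarget : (c : Merged) → DescOf T C (proj₁ c) d
    pathToTarget (_ , _ , _ , _ , _ , ps , _) = ps

    nodesToTarget : Merged → List (Component n)
    nodesToTarget c = pathNodes (pathToTarget c)

    mergesInto-nodesToTarget : ∀ L {e} → e ∈ₗ concatMap nodesToTarget L → MergesInto e
    mergesInto-nodesToTarget L e∈ =
      let ((_ , mc) , _ , e∈nodes) = find (∈-concatMap⁻ nodesToTarget {xs = L} e∈)
      in mergesInto-along _ mc e∈nodes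

    mergeOf : S d → d ∈ₗ C → ∀ x →
              (∀ v → (v ∈ x) ⇔ (v ∈ d ⊎ ∃[ c ] (c ∈ₗ C × c ∉ₗ F × ¬ S c × ClosestIn T C S c d × v ∈ c))) →
              ∃[ K ] ConnectedMergeOf C x K
    mergeOf Sd d∈C x x≡merge = K , (λ ()) , K⊆C , K-covers , K-connected
      where
      outside-d : ∀ {v} → v ∈ x × ¬ v ∈ d → ∃[ c ] v ∈ proj₁ {B = MergesInto} c
      outside-d {v} (v∈x , v∉d) with to (x≡merge v) v∈x
      ... | inj₁ v∈d = contradiction v∈d v∉d
      ... | inj₂ (c , c∈C , c∉F , ¬Sc , cl , v∈c) = (c , c∈C , c∉F , ¬Sc , cl) , v∈c

      covering : ∃[ L ] (∀ {v} → v ∈ x × ¬ v ∈ d → ∃[ c ] (c ∈ₗ L × v ∈ proj₁ c))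
      covering = finite-choice (λ v → (v ∈? x) ×-dec ¬? (v ∈? d)) outside-d

      L : List Merged
      L = proj₁ covering

      cover : ∀ {v} → v ∈ x × ¬ v ∈ d → ∃[ c ] (c ∈ₗ L × v ∈ proj₁ c)
      cover = proj₂ covering

      K : List (Component n)
      K = d ∷ concatMap nodesToTarget L

      K⊆C : ∀ c → c ∈ₗ K → c ∈ₗ C
      K⊆C _ (here refl) = d∈C
      K⊆C _ (there c∈)  = proj₁ (mergesInto-nodesToTarget L c∈)

      K-covers : ∀ v → (v ∈ x) ⇔ (∃[ c ] (c ∈ₗ K × v ∈ c))
      K-covers v = mk⇔ into back
        where
        into : v ∈ x → ∃[ c ] (c ∈ₗ K × v ∈ c)
        into v∈x with v ∈? d
        ... | yes v∈d = d , here refl , v∈d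
        ... | no v∉d  =
          let (c , c∈L , v∈c) = cover (v∈x , v∉d)
          in proj₁ c , there (∈-concatMap⁺ nodesToTarget (lose c∈L (source∈pathNodes (pathToTarget c)))) , v∈c
        back : ∃[ c ] (c ∈ₗ K × v ∈ c) → v ∈ x
        back (_ , here refl , v∈d) = from (x≡merge v) (inj₁ v∈d)
        back (c , there c∈ , v∈c) =
          let (c∈C , c∉F , ¬Sc , cl) = mergesInto-nodesToTarget L c∈
          in from (x≡merge v) (inj₂ (c , c∈C , c∉F , ¬Sc , cl , v∈c))

      Edge : Rel (Component n) _
      Edge p q = p ∈ₗ K × q ∈ₗ K × (ChildOf T C p q ⊎ ChildOf T C q p)

      Edge-sym : Symmetric Edge
      Edge-sym (p∈ , q∈ , inj₁ pq) = q∈ , p∈ , inj₂ pq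
      Edge-sym (p∈ , q∈ , inj₂ qp) = q∈ , p∈ , inj₁ qp

      induced⇒Edge : ∀ {p q} → InducedOn {R = ChildOf T C} (_∈ₗ K) p q → Edge p q
      induced⇒Edge (p∈ , q∈ , pq) = p∈ , q∈ , inj₁ pq

      reaches-d : ∀ {e} → e ∈ₗ K → Star Edge e d
      reaches-d (here refl) = ε
      reaches-d (there e∈) =
        let (c , c∈L , e∈nodes) = find (∈-concatMap⁻ nodesToTarget {xs = L} e∈)
        in gmap id induced⇒Edge
             (pathNodes-reach (pathToTarget c) (nodes⊆K c∈L) (here refl) e∈nodes)
        where
        nodes⊆K : ∀ {c z} → c ∈ₗ L → z ∈ₗ nodesToTarget c → z ∈ₗ K
        nodes⊆K c∈L z∈ = there (∈-concatMap⁺ nodesToTarget (lose c∈L z∈))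

      K-connected : ConnectedIn T C K
      K-connected _ _ = hub-connected Edge-sym reaches-d

claim1 : ∀ {n} (T : BinaryTree n) (m : ℕ) → 0 < m →
         ∀ C F C' F' → Reachable T m (C , F) → Step T m (C , F) (C' , F') →
         ∀ x → x ∈ₗ C' →
         ∃[ K ] (K ≢ [] × (∀ c → c ∈ₗ K → c ∈ₗ C) ×
                 (∀ v → (v ∈ x) ⇔ (∃[ c ] (c ∈ₗ K × v ∈ c))) ×
                 ConnectedIn T C K)
claim1 T m _ C F C' F' reach st x x∈C' with to (Step.C'-def st x) x∈C'
... | inj₁ x∈F = x ∷ [] , singleton-mergeOf T (completed⊆components T reach x∈F)
... | inj₂ (d , Sd , x≡merge) =
  Merge.mergeOf T C F S S-parentInF d Sd (proj₁ (to (S-def d) Sd)) x x≡merge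
  where
  open Step st using (S; S-def)
  S-parentInF : ∀ {c} → c ∈ₗ C → c ∉ₗ F → ParentIn T C F c → S c
  S-parentInF {c} c∈C c∉F pF = from (S-def c) (c∈C , c∉F , inj₂ (inj₂ (inj₁ pF)))
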